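{- Every model satisfies A4$^*$d: for all $\alpha<\kappa$, any index set $I$ and elements $x_i,y_i$ ($i\in I$) with $x_i=_\alpha y_i$ for all $i$, one has $\bigwedge_{i\in I}x_i=_\alpha\bigwedge_{i\in I}y_i$.
   Context: Fix a limit ordinal $\kappa$. A stratified complete lattice is $(L,\leq,(\sqsubseteq_\alpha)_{\alpha<\kappa})$ with $(L,\leq)$ a complete lattice and each $\sqsubseteq_\alpha$ a preorder; $x=_\alpha y$ means $x\sqsubseteq_\alpha y$ and $y\sqsubseteq_\alpha x$. A model satisfies: (A1) for $\alpha<\beta<\kappa$, $x\sqsubseteq_\beta y$ implies $x=_\alpha y$; (A2) if $x=_\alpha y$ for all $\alpha$ then $x=y$; (A3) for all $x,\alpha$ there is $y$ with $x=_\alpha y$ such that $x\sqsubseteq_\alpha z$ implies $y\leq z$ (unique, denoted $x|_\alpha$); (A4) for nonempty $I$ and $x_i=_\alpha y$ ($i\in I$), $\bigvee_i x_i=_\alpha y$; (A5) $x\leq y$ implies $x|_\alpha\leq y|_\alpha$; (A6) if $x\leq y$ and $x=_\beta y$ for all $\beta<\alpha$ then $x\sqsubseteq_\alpha y$. -}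

module Defs where

open import Level using (Level; _⊔_) renaming (suc to lsuc)
open import Data.Product using (Σ; _×_; proj₁)
open import Relation.Binary.PropositionalEquality using (_≡_)
open import Relation.Binary.Structures using (IsPartialOrder; IsPreorder; IsStrictTotalOrder)
open import Induction.WellFounded using (WellFounded)

-- A limit ordinal κ, represented by the well-ordered type of ordinals α < κ:
-- a strict total well-founded order which is nonempty (κ ≠ 0) and has no
-- greatest element (κ is not a successor).
record LimitOrdinal (k : Level) : Set (lsuc k) where
  field
    Ord        : Set k
    _<_        : Ord → Ord → Set k
    isSTO      : IsStrictTotalOrder _≡_ _<_
    wellFounded : WellFounded _<_
    nonempty   : Ord
    noMax      : (α : Ord) → Σ Ord (λ β → α < β)

record StratifiedCompleteLattice {k : Level} (κ : LimitOrdinal k) (ℓ : Level)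
       : Set (lsuc (k ⊔ ℓ)) where
  open LimitOrdinal κ
  field
    Carrier    : Set ℓ
    _≤_        : Carrier → Carrier → Set ℓ
    isPartialOrder : IsPartialOrder _≡_ _≤_
    ⋁          : {I : Set ℓ} → (I → Carrier) → Carrier
    ⋁-upper    : {I : Set ℓ} (x : I → Carrier) (i : I) → x i ≤ ⋁ x
    ⋁-least    : {I : Set ℓ} (x : I → Carrier) (z : Carrier) →
                 ((i : I) → x i ≤ z) → ⋁ x ≤ z
    ⋀          : {I : Set ℓ} → (I → Carrier) → Carrier
    ⋀-lower    : {I : Set ℓ} (x : I → Carrier) (i : I) → ⋀ x ≤ x i
    ⋀-greatest : {I : Set ℓ} (x : I → Carrier) (z : Carrier) →
                 ((i : I) → z ≤ x i) → z ≤ ⋀ x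
    _⊑[_]_     : Carrier → Ord → Carrier → Set ℓ
    ⊑-preorder : (α : Ord) → IsPreorder _≡_ (λ x y → x ⊑[ α ] y)

  _=[_]_ : Carrier → Ord → Carrier → Set ℓ
  x =[ α ] y = (x ⊑[ α ] y) × (y ⊑[ α ] x)

record IsModel {k ℓ : Level} {κ : LimitOrdinal k}
       (S : StratifiedCompleteLattice κ ℓ) : Set (k ⊔ lsuc ℓ) where
  open LimitOrdinal κ
  open StratifiedCompleteLattice S
  field
    A1 : (α β : Ord) → α < β → (x y : Carrier) → x ⊑[ β ] y → x =[ α ] y
    A2 : (x y : Carrier) → ((α : Ord) → x =[ α ] y) → x ≡ y
    A3 : (x : Carrier) (α : Ord) →
         Σ Carrier (λ y → (x =[ α ] y) × ((z : Carrier) → x ⊑[ α ] z → y ≤ z))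

  -- x|_α (unique by antisymmetry of ≤)
  _∣_ : Carrier → Ord → Carrier
  x ∣ α = proj₁ (A3 x α)

  field
    A4 : (α : Ord) {I : Set ℓ} → I → (x : I → Carrier) (y : Carrier) →
         ((i : I) → x i =[ α ] y) → ⋁ x =[ α ] y
    A5 : (α : Ord) (x y : Carrier) → x ≤ y → (x ∣ α) ≤ (y ∣ α)
    A6 : (α : Ord) (x y : Carrier) → x ≤ y →
         ((β : Ord) → β < α → x =[ β ] y) → x ⊑[ α ] y

module Submission where

-- The key observation is a
-- criterion for x ⊑_α y in terms of the restriction x|_α (`⊑-viaRestriction`):
-- if x|_α ≤ y and x =_β y at all lower levels β < α, then x ⊑_α y, because
-- x =_α x|_α and (A6) upgrades x|_α ≤ y to x|_α ⊑_α y.  For meets, the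
-- inequality (⋀ x)|_α ≤ ⋀ y follows from (A5) and minimality of restrictions,
-- while the lower levels are supplied by the induction hypothesis; this gives
-- the one-sided statement `⋀-mono-⊑`.

open import Level using (Level)
open import Data.Product using (_,_; proj₁; proj₂)
open import Relation.Binary.Structures using (IsPartialOrder; IsPreorder)
open import Induction.WellFounded using (Acc; acc)
open import Defs

module MeetsRespectStrata {k ℓ : Level} {κ : LimitOrdinal k}
                          (S : StratifiedCompleteLattice κ ℓ) (M : IsModel S) where
  open LimitOrdinal κ
  open StratifiedCompleteLattice S
  open IsModel M
  open IsPartialOrder isPartialOrder using () renaming (trans to ≤-trans)

  =-sym : (α : Ord) {x y : Carrier} → x =[ α ] y → y =[ α ] x
  =-sym α (p , q) = q , p

  =-trans : (α : Ord) {x y z : Carrier} → x =[ α ] y → y =[ α ] z → x =[ α ] z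
  =-trans α (p , q) (r , s) = ⊑-trans p r , ⊑-trans s q
    where open IsPreorder (⊑-preorder α) using () renaming (trans to ⊑-trans)

  module _ (α : Ord) where
    open IsPreorder (⊑-preorder α) using () renaming (trans to ⊑-trans)

    restriction-equal : (x : Carrier) → x =[ α ] (x ∣ α)
    restriction-equal x = proj₁ (proj₂ (A3 x α))

    restriction-least : (x z : Carrier) → x ⊑[ α ] z → (x ∣ α) ≤ z
    restriction-least x = proj₂ (proj₂ (A3 x α))

    ⊑-viaRestriction : (x y : Carrier) → (x ∣ α) ≤ y →
                       ((β : Ord) → β < α → x =[ β ] y) → x ⊑[ α ] y
    ⊑-viaRestriction x y x∣α≤y lower =
      ⊑-trans (proj₁ (restriction-equal x)) (A6 α (x ∣ α) y x∣α≤y restrictionLower)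
      where
      -- x|_α =_α x, hence x|_α =_β x at every lower level by (A1).
      restrictionLower : (β : Ord) → β < α → (x ∣ α) =[ β ] y
      restrictionLower β β<α =
        =-trans β (A1 β α β<α (x ∣ α) x (proj₂ (restriction-equal x))) (lower β β<α)

    ⋀-mono-⊑ : {I : Set ℓ} (x y : I → Carrier) → ((i : I) → x i ⊑[ α ] y i) →
               ((β : Ord) → β < α → ⋀ x =[ β ] ⋀ y) → ⋀ x ⊑[ α ] ⋀ y
    ⋀-mono-⊑ x y x⊑y = ⊑-viaRestriction (⋀ x) (⋀ y) restrictionBelow
      where
      -- (⋀ x)|_α ≤ (x i)|_α ≤ y i  for every i.
      restrictionBelow : (⋀ x ∣ α) ≤ ⋀ y
      restrictionBelow = ⋀-greatest y (⋀ x ∣ α) λ i →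
        ≤-trans (A5 α (⋀ x) (x i) (⋀-lower x i)) (restriction-least (x i) (y i) (x⊑y i))

  ⋀-respects-= : (α : Ord) → Acc _<_ α → {I : Set ℓ} (x y : I → Carrier) →
                 ((i : I) → x i =[ α ] y i) → ⋀ x =[ α ] ⋀ y
  ⋀-respects-= α (acc below) x y x=y =
    ⋀-mono-⊑ α x y (λ i → proj₁ (x=y i)) lowerLevels ,
    ⋀-mono-⊑ α y x (λ i → proj₂ (x=y i)) (λ β β<α → =-sym β (lowerLevels β β<α))
    where
    -- By (A1) the hypothesis holds at every β < α, so induction applies there.
    lowerLevels : (β : Ord) → β < α → ⋀ x =[ β ] ⋀ y
    lowerLevels β β<α =
      ⋀-respects-= β (below β<α) x y λ i → A1 β α β<α (x i) (y i) (proj₁ (x=y i))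

lemma24 : {k ℓ : Level} {κ : LimitOrdinal k} (S : StratifiedCompleteLattice κ ℓ) →
          IsModel S →
          let open LimitOrdinal κ
              open StratifiedCompleteLattice S
          in (α : Ord) {I : Set ℓ} (x y : I → Carrier) →
             ((i : I) → x i =[ α ] y i) → ⋀ x =[ α ] ⋀ y
lemma24 {κ = κ} S M α =
  MeetsRespectStrata.⋀-respects-= S M α (LimitOrdinal.wellFounded κ α)
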